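{- Let $h,k\ge 0$. Then for every digraph $G$ there is a partition of $V(G)$ into three sets $P,Q,R$ such that $G[P]$ is $(h,k)$-out-orderable, $G[Q]$ is $(h,k)$-in-orderable and $G[R]$ is $(h,k)$-robust.
   Context: Digraphs are finite orientations of simple graphs; for $X\subseteq V(G)$, $\chi(X)$ is the chromatic number of the underlying undirected graph of $G[X]$; $N^+(v)$, $N^-(v)$ are the out- and in-neighbourhoods of $v$. A digraph $G$ is $(h,k)$-out-orderable if there is a partition $X_1,\ldots,X_n$ ($n\ge 0$) of $V(G)$ such that for $1\le i\le n$, $\chi(X_i)\le h$ and each vertex of $X_i$ has at most $k-1$ out-neighbours in $X_{i+1}\cup\cdots\cup X_n$; $(h,k)$-in-orderable is defined the same way with in-neighbours in place of out-neighbours. $G$ is $(h,k)$-robust if for every nonempty $Z\subseteq V(G)$ with $\chi(Z)\le h$, some vertex of $Z$ has at least $k$ out-neighbours in $V(G)\setminus Z$ and at least $k$ in-neighbours in $V(G)\setminus Z$. (The sets $P,Q,R$ may be empty.) -}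

module Defs where

open import Data.Nat using (ℕ; _<_; _≤_; _+_)
open import Data.Bool using (Bool; true; false; _∨_)
open import Data.Fin using (Fin)
open import Data.Fin.Subset using (Subset; _∈_; _⊆_; _∩_; _─_; ∣_∣; Nonempty; Empty)
open import Data.Vec using (tabulate)
open import Data.List using (List; []; _∷_)
open import Data.Product using (Σ; ∃; _×_; _,_)
open import Data.Sum using (_⊎_)
open import Relation.Binary.PropositionalEquality using (_≡_; _≢_)

-- A digraph: finite orientation of a simple graph, on vertex set Fin n.
-- adj u v ≡ true  means there is an arc u → v.
record Digraph : Set where
  field
    n       : ℕ
    adj     : Fin n → Fin n → Bool
    loopless : ∀ v → adj v v ≡ false
    oriented : ∀ u v → adj u v ≡ true → adj v u ≡ false

open Digraph public

module _ (G : Digraph) where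

  uadj : Fin (n G) → Fin (n G) → Bool
  uadj u v = adj G u v ∨ adj G v u

  ChromaticAtMost : Subset (n G) → ℕ → Set
  ChromaticAtMost X h =
    Σ (Fin (n G) → Fin h) λ c →
      ∀ u v → u ∈ X → v ∈ X → uadj u v ≡ true → c u ≢ c v

  outNbrs : Fin (n G) → Subset (n G)
  outNbrs v = tabulate (λ w → adj G v w)

  inNbrs : Fin (n G) → Subset (n G)
  inNbrs v = tabulate (λ w → adj G w v)

  outDegIn : Fin (n G) → Subset (n G) → ℕ
  outDegIn v S = ∣ outNbrs v ∩ S ∣

  inDegIn : Fin (n G) → Subset (n G) → ℕ
  inDegIn v S = ∣ inNbrs v ∩ S ∣

  -- OutOrdering h k P Xs : the list Xs = X₁,…,Xₘ is a partition of P with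
  -- χ(Xᵢ) ≤ h and every vertex of Xᵢ having at most k-1 (i.e. < k)
  -- out-neighbours in Xᵢ₊₁ ∪ ⋯ ∪ Xₘ  (= P ─ X₁ ─ ⋯ ─ Xᵢ).
  OutOrdering : ℕ → ℕ → Subset (n G) → List (Subset (n G)) → Set
  OutOrdering h k P [] = Empty P
  OutOrdering h k P (X ∷ Xs) =
    X ⊆ P × ChromaticAtMost X h
    × (∀ v → v ∈ X → outDegIn v (P ─ X) < k)
    × OutOrdering h k (P ─ X) Xs

  InOrdering : ℕ → ℕ → Subset (n G) → List (Subset (n G)) → Set
  InOrdering h k P [] = Empty P
  InOrdering h k P (X ∷ Xs) =
    X ⊆ P × ChromaticAtMost X h
    × (∀ v → v ∈ X → inDegIn v (P ─ X) < k)
    × InOrdering h k (P ─ X) Xs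

  OutOrderable : ℕ → ℕ → Subset (n G) → Set
  OutOrderable h k P = ∃ λ Xs → OutOrdering h k P Xs

  InOrderable : ℕ → ℕ → Subset (n G) → Set
  InOrderable h k P = ∃ λ Xs → InOrdering h k P Xs

  Robust : ℕ → ℕ → Subset (n G) → Set
  Robust h k R =
    ∀ Z → Z ⊆ R → Nonempty Z → ChromaticAtMost Z h →
      ∃ λ v → v ∈ Z × k ≤ outDegIn v (R ─ Z) × k ≤ inDegIn v (R ─ Z)

  Partition3 : Subset (n G) → Subset (n G) → Subset (n G) → Set
  Partition3 P Q R =
    (∀ v → v ∈ P ⊎ v ∈ Q ⊎ v ∈ R)
    × Empty (P ∩ Q) × Empty (P ∩ R) × Empty (Q ∩ R)

-- Peel the vertex set: as long as the remaining set R is not (h,k)-robust, some nonempty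
-- Z ⊆ R with χ(Z) ≤ h has every vertex of few out-neighbours or of few in-neighbours in
-- R ─ Z. Put the first kind of vertex as the next layer of the out-ordering and the others
-- as the next layer of the in-ordering, and continue with R ─ Z. Layers are prepended, so
-- the out- and in-neighbours that count are those in the layers built later, all inside
-- R ─ Z. The process stops, with a robust remainder, because R strictly shrinks.
module Submission where

open import Defs
open import Data.Nat using (ℕ; zero; suc; _<_; _≤_; _<?_)
open import Data.Nat.Properties using (≤-<-trans; ≮⇒≥)
open import Data.Nat.Induction using (<-wellFounded)
open import Data.Product using (∃; _×_; _,_; proj₁; proj₂)
open import Data.Sum as Sum using (_⊎_; inj₁; inj₂)
open import Data.Bool.Properties using (T-≡) renaming (_≟_ to _≟ᵇ_)
open import Data.Empty using (⊥-elim)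
open import Data.Fin using (Fin; zero; suc) renaming (_≟_ to _≟ᶠ_)
open import Data.Fin.Properties using (any?; all?; ¬∀⟶∃¬)
open import Data.Fin.Subset using (Subset; _∈_; _∉_; _⊆_; _∩_; _∪_; _─_; ∣_∣; Nonempty; Empty; ⊥; ⊤)
open import Data.Fin.Subset.Properties
  using (_∈?_; _⊆?_; nonempty?; anySubset?; ∉⊥; ⊥⊆; ∈⊤; ⊆-antisym; p⊆q⇒∣p∣≤∣q∣; x∈p∩q⁺; x∈p∩q⁻;
         p⊆p∪q; q⊆p∪q; x∈p∪q⁻; x∈p∧x∉q⇒x∈p─q; p─q⊆p; p∩q≢∅⇒∣p─q∣<∣p∣)
open import Data.Bool using (true)
open import Data.List using ([]; _∷_)
open import Data.Vec using (_∷_; here; there; tabulate)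
open import Data.Vec.Functional using () renaming (_∷_ to _∷ᶠ_)
open import Data.Vec.Properties using (lookup∘tabulate; []=⇒lookup; lookup⇒[]=)
open import Function using (id; _∘_; Equivalence)
open import Induction.WellFounded using (module All)
open import Level using (0ℓ)
open import Relation.Binary.Construct.On using (wellFounded)
open import Relation.Nullary using (Dec; yes; no)
open import Relation.Nullary.Decidable using (isYes; toWitness; decidable-stable; fromWitness; _×-dec_; _⊎-dec_; _→-dec_; ¬?)
open import Relation.Unary using (Pred; Decidable)
open import Relation.Binary.PropositionalEquality using (_≡_; _≢_; _≗_; refl; sym; trans; subst)

x∈p─q⇒x∉q : ∀ {m} (p q : Subset m) {x} → x ∈ p ─ q → x ∉ q
x∈p─q⇒x∉q (_ ∷ p) (true ∷ q) () here
x∈p─q⇒x∉q (_ ∷ p) (_ ∷ q) (there x∈) (there x∈q) = x∈p─q⇒x∉q p q x∈ x∈q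

module _ {m : ℕ} where

  select : ∀ {ℓ} {P : Pred (Fin m) ℓ} → Decidable P → Subset m
  select P? = tabulate (isYes ∘ P?)

  module _ {ℓ} {P : Pred (Fin m) ℓ} (P? : Decidable P) {x : Fin m} where

    ∈-select⁻ : x ∈ select P? → P x
    ∈-select⁻ x∈ = toWitness (Equivalence.from T-≡ (trans (sym (lookup∘tabulate _ x)) ([]=⇒lookup x∈)))

    ∈-select⁺ : P x → x ∈ select P?
    ∈-select⁺ px = lookup⇒[]= x _ (trans (lookup∘tabulate _ x) (Equivalence.to T-≡ (fromWitness px)))

  Disjoint : Subset m → Subset m → Set
  Disjoint p q = Empty (p ∩ q)

  disjoint-sym : ∀ {p q : Subset m} → Disjoint p q → Disjoint q p
  disjoint-sym {p} {q} d (x , x∈q∩p) = let (x∈q , x∈p) = x∈p∩q⁻ q p x∈q∩p in d (x , x∈p∩q⁺ (x∈p , x∈q))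

  disjoint-∪ˡ : ∀ {p q r : Subset m} → Disjoint p r → Disjoint q r → Disjoint (p ∪ q) r
  disjoint-∪ˡ {p} {q} {r} dp dq (x , x∈) with x∈p∩q⁻ (p ∪ q) r x∈
  ... | x∈p∪q , x∈r with x∈p∪q⁻ p q x∈p∪q
  ... | inj₁ x∈p = dp (x , x∈p∩q⁺ (x∈p , x∈r))
  ... | inj₂ x∈q = dq (x , x∈p∩q⁺ (x∈q , x∈r))

  disjoint-∪ʳ : ∀ {p q r : Subset m} → Disjoint p q → Disjoint p r → Disjoint p (q ∪ r)
  disjoint-∪ʳ dq dr = disjoint-sym (disjoint-∪ˡ (disjoint-sym dq) (disjoint-sym dr))

  ⊆-─-disjoint : ∀ {p q r s : Subset m} → p ⊆ r → q ⊆ s ─ r → Disjoint p q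
  ⊆-─-disjoint {p} {q} {r} {s} p⊆r q⊆s─r (x , x∈) =
    let (x∈p , x∈q) = x∈p∩q⁻ p q x∈ in x∈p─q⇒x∉q s r (q⊆s─r x∈q) (p⊆r x∈p)

  ∪-⊆ : ∀ {p q r : Subset m} → p ⊆ r → q ⊆ r → p ∪ q ⊆ r
  ∪-⊆ {p} {q} p⊆r q⊆r x∈ with x∈p∪q⁻ p q x∈
  ... | inj₁ x∈p = p⊆r x∈p
  ... | inj₂ x∈q = q⊆r x∈q

  p∪q─p≡q : ∀ (p q : Subset m) → Disjoint p q → (p ∪ q) ─ p ≡ q
  p∪q─p≡q p q d = ⊆-antisym ⊆q q⊆
    where
    ⊆q : (p ∪ q) ─ p ⊆ q
    ⊆q x∈ with x∈p∪q⁻ p q (p─q⊆p (p ∪ q) p x∈)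
    ... | inj₁ x∈p = ⊥-elim (x∈p─q⇒x∉q (p ∪ q) p x∈ x∈p)
    ... | inj₂ x∈q = x∈q
    q⊆ : q ⊆ (p ∪ q) ─ p
    q⊆ {x} x∈q = x∈p∧x∉q⇒x∈p─q (q⊆p∪q p q x∈q) (λ x∈p → d (x , x∈p∩q⁺ (x∈p , x∈q)))

  ⊥-empty : Empty (⊥ {m})
  ⊥-empty (_ , x∈⊥) = ∉⊥ x∈⊥

  ⊥-disjoint : ∀ {p : Subset m} → Disjoint ⊥ p
  ⊥-disjoint {p} (x , x∈) = ∉⊥ (proj₁ (x∈p∩q⁻ ⊥ p x∈))

  ∣∩∣-monoʳ : ∀ (p : Subset m) {q r : Subset m} → q ⊆ r → ∣ p ∩ q ∣ ≤ ∣ p ∩ r ∣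
  ∣∩∣-monoʳ p {q} q⊆r = p⊆q⇒∣p∣≤∣q∣ λ x∈ → let (x∈p , x∈q) = x∈p∩q⁻ p q x∈ in x∈p∩q⁺ (x∈p , q⊆r x∈q)

∷-cong : ∀ {m} {A : Set} (a : A) {f g : Fin m → A} → f ≗ g → (a ∷ᶠ f) ≗ (a ∷ᶠ g)
∷-cong a f≗g zero = refl
∷-cong a f≗g (suc i) = f≗g i

head∷tail≗ : ∀ {m} {A : Set} (f : Fin (suc m) → A) → f ≗ (f zero ∷ᶠ (f ∘ suc))
head∷tail≗ f zero = refl
head∷tail≗ f (suc i) = refl

any-function? : ∀ {m k ℓ} {P : Pred (Fin m → Fin k) ℓ} →
                (∀ {f g} → f ≗ g → P f → P g) → Decidable P → Dec (∃ P)
any-function? {zero} resp P? with P? (λ ())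
... | yes p = yes (_ , p)
... | no ¬p = no λ (f , p) → ¬p (resp (λ ()) p)
any-function? {suc m} resp P? with any? (λ a → any-function? (resp ∘ ∷-cong a) (P? ∘ (a ∷ᶠ_)))
... | yes (a , f , p) = yes (a ∷ᶠ f , p)
... | no ¬p = no λ (f , p) → ¬p (f zero , f ∘ suc , resp (head∷tail≗ f) p)

module _ (G : Digraph) where

  ProperColouring : ∀ {h} → Subset (n G) → (Fin (n G) → Fin h) → Set
  ProperColouring X c = ∀ u v → u ∈ X → v ∈ X → uadj G u v ≡ true → c u ≢ c v

  properColouring? : ∀ {h} (X : Subset (n G)) → Decidable (ProperColouring {h} X)
  properColouring? X c = all? λ u → all? λ v →
    (u ∈? X) →-dec (v ∈? X) →-dec (uadj G u v ≟ᵇ true) →-dec ¬? (c u ≟ᶠ c v)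

  properColouring-resp : ∀ {h} (X : Subset (n G)) {c c′ : Fin (n G) → Fin h} →
                         c ≗ c′ → ProperColouring X c → ProperColouring X c′
  properColouring-resp X c≗c′ proper u v u∈X v∈X uv c′u≡c′v =
    proper u v u∈X v∈X uv (trans (c≗c′ u) (trans c′u≡c′v (sym (c≗c′ v))))

  chromaticAtMost? : ∀ (X : Subset (n G)) h → Dec (ChromaticAtMost G X h)
  chromaticAtMost? X h = any-function? (properColouring-resp X) (properColouring? X)

  chromaticAtMost-⊆ : ∀ {X Y : Subset (n G)} {h} → X ⊆ Y → ChromaticAtMost G Y h → ChromaticAtMost G X h
  chromaticAtMost-⊆ X⊆Y (c , proper) = c , λ u v u∈X v∈X → proper u v (X⊆Y u∈X) (X⊆Y v∈X)

  module _ (h k : ℕ) where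

    Weak : Subset (n G) → Subset (n G) → Pred (Fin (n G)) 0ℓ
    Weak R Z v = v ∈ Z → outDegIn G v (R ─ Z) < k ⊎ inDegIn G v (R ─ Z) < k

    weak? : ∀ R Z → Decidable (Weak R Z)
    weak? R Z v = (v ∈? Z) →-dec (outDegIn G v (R ─ Z) <? k ⊎-dec inDegIn G v (R ─ Z) <? k)

    Obstruction : Subset (n G) → Subset (n G) → Set
    Obstruction R Z = Z ⊆ R × Nonempty Z × ChromaticAtMost G Z h × (∀ v → Weak R Z v)

    obstruction? : ∀ R → Decidable (Obstruction R)
    obstruction? R Z = Z ⊆? R ×-dec nonempty? Z ×-dec chromaticAtMost? Z h ×-dec all? (weak? R Z)

    robust-or-obstruction : ∀ R → Robust G h k R ⊎ ∃ (Obstruction R)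
    robust-or-obstruction R with anySubset? (obstruction? R)
    ... | yes obstruction = inj₂ obstruction
    ... | no ¬obstruction = inj₁ λ Z Z⊆R Z≢∅ χZ →
      let (v , ¬weak) = ¬∀⟶∃¬ (n G) _ (weak? R Z) (λ weak → ¬obstruction (Z , Z⊆R , Z≢∅ , χZ , weak))
      in v , decidable-stable (v ∈? Z) (λ v∉Z → ¬weak (⊥-elim ∘ v∉Z))
           , ≮⇒≥ (λ few → ¬weak λ _ → inj₁ few) , ≮⇒≥ (λ few → ¬weak λ _ → inj₂ few)

    outOrderable-∪ : ∀ {X P : Subset (n G)} → Disjoint X P → ChromaticAtMost G X h →
                     (∀ v → v ∈ X → outDegIn G v P < k) → OutOrderable G h k P → OutOrderable G h k (X ∪ P)
    outOrderable-∪ {X} {P} X∩P≡∅ χX few (Xs , ordering) =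
      X ∷ Xs , p⊆p∪q P , χX
      , subst (λ S → ∀ v → v ∈ X → outDegIn G v S < k) (sym rest) few
      , subst (λ S → OutOrdering G h k S Xs) (sym rest) ordering
      where rest = p∪q─p≡q X P X∩P≡∅

    inOrderable-∪ : ∀ {X Q : Subset (n G)} → Disjoint X Q → ChromaticAtMost G X h →
                    (∀ v → v ∈ X → inDegIn G v Q < k) → InOrderable G h k Q → InOrderable G h k (X ∪ Q)
    inOrderable-∪ {X} {Q} X∩Q≡∅ χX few (Xs , ordering) =
      X ∷ Xs , p⊆p∪q Q , χX
      , subst (λ S → ∀ v → v ∈ X → inDegIn G v S < k) (sym rest) few
      , subst (λ S → InOrdering G h k S Xs) (sym rest) ordering
      where rest = p∪q─p≡q X Q X∩Q≡∅

    record Decomposition (S : Subset (n G)) : Set where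
      field
        P Q R : Subset (n G)
        covers : ∀ v → v ∈ S → v ∈ P ⊎ v ∈ Q ⊎ v ∈ R
        P⊆S : P ⊆ S
        Q⊆S : Q ⊆ S
        R⊆S : R ⊆ S
        P∩Q≡∅ : Disjoint P Q
        P∩R≡∅ : Disjoint P R
        Q∩R≡∅ : Disjoint Q R
        out-orderable : OutOrderable G h k P
        in-orderable : InOrderable G h k Q
        robust : Robust G h k R

    robust-decomposition : ∀ {S} → Robust G h k S → Decomposition S
    robust-decomposition {S} robust = record
      { P = ⊥ ; Q = ⊥ ; R = S
      ; covers = λ _ v∈S → inj₂ (inj₂ v∈S)
      ; P⊆S = ⊥⊆ ; Q⊆S = ⊥⊆ ; R⊆S = λ v∈S → v∈S
      ; P∩Q≡∅ = ⊥-disjoint ; P∩R≡∅ = ⊥-disjoint ; Q∩R≡∅ = ⊥-disjoint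
      ; out-orderable = [] , ⊥-empty
      ; in-orderable = [] , ⊥-empty
      ; robust = robust
      }

    extend-by-obstruction : ∀ {R Z} → Obstruction R Z → Decomposition (R ─ Z) → Decomposition R
    extend-by-obstruction {R} {Z} (Z⊆R , _ , χZ , weak) D = record
      { P = Zᵒ ∪ D.P ; Q = Zⁱ ∪ D.Q ; R = D.R
      ; covers = covers
      ; P⊆S = ∪-⊆ (Z⊆R ∘ Zᵒ⊆Z) (p─q⊆p R Z ∘ D.P⊆S)
      ; Q⊆S = ∪-⊆ (Z⊆R ∘ Zⁱ⊆Z) (p─q⊆p R Z ∘ D.Q⊆S)
      ; R⊆S = p─q⊆p R Z ∘ D.R⊆S
      ; P∩Q≡∅ = disjoint-∪ˡ (disjoint-∪ʳ (⊆-─-disjoint {s = Z} id id) (⊆-─-disjoint Zᵒ⊆Z D.Q⊆S))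
                            (disjoint-∪ʳ (disjoint-sym (⊆-─-disjoint Zⁱ⊆Z D.P⊆S)) D.P∩Q≡∅)
      ; P∩R≡∅ = disjoint-∪ˡ (⊆-─-disjoint Zᵒ⊆Z D.R⊆S) D.P∩R≡∅
      ; Q∩R≡∅ = disjoint-∪ˡ (⊆-─-disjoint Zⁱ⊆Z D.R⊆S) D.Q∩R≡∅
      ; out-orderable = outOrderable-∪ (⊆-─-disjoint Zᵒ⊆Z D.P⊆S) (chromaticAtMost-⊆ Zᵒ⊆Z χZ) out-few D.out-orderable
      ; in-orderable = inOrderable-∪ (⊆-─-disjoint Zⁱ⊆Z D.Q⊆S) (chromaticAtMost-⊆ Zⁱ⊆Z χZ) in-few D.in-orderable
      ; robust = D.robust
      }
      where
      module D = Decomposition D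
      Zᵒ = select (λ v → v ∈? Z ×-dec outDegIn G v (R ─ Z) <? k)
      Zⁱ = Z ─ Zᵒ
      Zᵒ⊆Z : Zᵒ ⊆ Z
      Zᵒ⊆Z = proj₁ ∘ ∈-select⁻ _
      Zⁱ⊆Z : Zⁱ ⊆ Z
      Zⁱ⊆Z = p─q⊆p Z Zᵒ
      out-few : ∀ v → v ∈ Zᵒ → outDegIn G v D.P < k
      out-few v v∈Zᵒ = ≤-<-trans (∣∩∣-monoʳ (outNbrs G v) D.P⊆S) (proj₂ (∈-select⁻ _ v∈Zᵒ))
      in-few : ∀ v → v ∈ Zⁱ → inDegIn G v D.Q < k
      in-few v v∈Zⁱ with weak v (Zⁱ⊆Z v∈Zⁱ)
      ... | inj₁ few = ⊥-elim (x∈p─q⇒x∉q Z Zᵒ v∈Zⁱ (∈-select⁺ _ (Zⁱ⊆Z v∈Zⁱ , few)))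
      ... | inj₂ few = ≤-<-trans (∣∩∣-monoʳ (inNbrs G v) D.Q⊆S) few
      covers : ∀ v → v ∈ R → v ∈ Zᵒ ∪ D.P ⊎ v ∈ Zⁱ ∪ D.Q ⊎ v ∈ D.R
      covers v v∈R with v ∈? Z | v ∈? Zᵒ
      ... | no v∉Z | _ = Sum.map (q⊆p∪q Zᵒ D.P) (Sum.map₁ (q⊆p∪q Zⁱ D.Q)) (D.covers v (x∈p∧x∉q⇒x∈p─q v∈R v∉Z))
      ... | yes _ | yes v∈Zᵒ = inj₁ (p⊆p∪q D.P v∈Zᵒ)
      ... | yes v∈Z | no v∉Zᵒ = inj₂ (inj₁ (p⊆p∪q D.Q (x∈p∧x∉q⇒x∈p─q v∈Z v∉Zᵒ)))

    decomposition : ∀ S → Decomposition S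
    decomposition = All.wfRec (wellFounded ∣_∣ <-wellFounded) _ Decomposition decompose
      where
      decompose : ∀ R → (∀ {S} → ∣ S ∣ < ∣ R ∣ → Decomposition S) → Decomposition R
      decompose R smaller with robust-or-obstruction R
      ... | inj₁ robust = robust-decomposition robust
      ... | inj₂ (Z , obstruction@(Z⊆R , (z , z∈Z) , _)) =
        extend-by-obstruction obstruction (smaller (p∩q≢∅⇒∣p─q∣<∣p∣ R Z (z , x∈p∩q⁺ (Z⊆R z∈Z , z∈Z))))

mainTheorem7 : (h k : ℕ) (G : Digraph) →
    ∃ λ (P : Subset (n G)) → ∃ λ (Q : Subset (n G)) → ∃ λ (R : Subset (n G)) →
    Partition3 G P Q R × OutOrderable G h k P × InOrderable G h k Q × Robust G h k R
mainTheorem7 h k G =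
  P , Q , R , ((λ v → covers v ∈⊤) , P∩Q≡∅ , P∩R≡∅ , Q∩R≡∅) , out-orderable , in-orderable , robust
  where open Decomposition (decomposition G h k ⊤)
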